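{- Let $G$ be a triangle-distinct graph with $n$ vertices and let $c>0$ be a real number. If $e(G)\ge\binom{n}{2}-cn$, then for any $k\in\{1,\dots,n\}$, the number of vertices of degree $n-k$ in $G$ is at most $k(4cn)^{1-1/2^{k-1}}$.
   Context: All graphs are finite and simple; $e(G)$ is the number of edges of $G$. The triangle-degree of a vertex is the number of triangles containing it; a graph is triangle-distinct if it has at least two vertices and the triangle-degrees of its vertices are pairwise distinct.
   Formalization: The parameter c ranges over the positive rationals instead of the positive reals. -}

module Defs where

open import Data.Bool using (Bool; true; false; if_then_else_; _∧_)
open import Data.Nat using (ℕ; zero; suc; _<ᵇ_; _≡ᵇ_)
open import Data.Fin using (Fin; toℕ)
open import Data.List using (List; map; allFin)
open import Data.Nat.ListAction using (sum)
open import Data.Integer using (+_)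
open import Data.Rational using (ℚ; _/_; _*_; 1ℚ)
open import Relation.Binary.PropositionalEquality using (_≡_)

record Graph (n : ℕ) : Set where
  field
    adj     : Fin n → Fin n → Bool
    sym     : ∀ i j → adj i j ≡ adj j i
    irrefl  : ∀ i → adj i i ≡ false
open Graph public

count : ∀ {n} → (Fin n → Bool) → ℕ
count {n} p = sum (map (λ i → if p i then 1 else 0) (allFin n))

degree : ∀ {n} → Graph n → Fin n → ℕ
degree G v = count (λ u → adj G v u)

edges : ∀ {n} → Graph n → ℕ
edges G = sum (map (λ i → count (λ j → (toℕ i <ᵇ toℕ j) ∧ adj G i j)) (allFin _))

triangleDegree : ∀ {n} → Graph n → Fin n → ℕ
triangleDegree G v =
  sum (map (λ u → count (λ w → (toℕ u <ᵇ toℕ w) ∧ (adj G v u ∧ (adj G v w ∧ adj G u w))))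
           (allFin _))

record TriangleDistinct {n : ℕ} (G : Graph n) : Set where
  field
    atLeastTwo : 2 Data.Nat.≤ n
    distinct   : ∀ u v → triangleDegree G u ≡ triangleDegree G v → u ≡ v

numOfDegree : ∀ {n} → Graph n → ℕ → ℕ
numOfDegree G d = count (λ v → degree G v ≡ᵇ d)

ℕ→ℚ : ℕ → ℚ
ℕ→ℚ m = + m / 1

_^ℚ_ : ℚ → ℕ → ℚ
q ^ℚ zero  = 1ℚ
q ^ℚ suc m = q * (q ^ℚ m)

{-# OPTIONS --safe #-}
module Submission where

-- Pass to the complement H of G. A vertex v of G-degree n − k has H-degree k − 1, and counting pairs of
-- G-neighbours of v gives 2 t_G(v) = d_G(v)² − d_G(v) + a_H(v) − 2 e(H), where a_H(v) is twice the number
-- of edges of H meeting the closed neighbourhood N_H[v]. So vertices of equal degree and distinct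
-- triangle-degrees have distinct values of a_H. For a set T of vertices of H-degree j with distinct a_H,
-- induction on j gives ∣T∣^(2^j) ≤ (8 e(H))^(2^j − 1): the values a_H(v) ≥ 1 are distinct, hence
-- ∣T∣² ≤ 2 ∑ a_H(v) ≤ 4 ∑_u d_H(u) ∣T ∩ N(u)∣ ≤ 8 e(H) max_u ∣T ∩ N(u)∣, and T ∩ N(u) is such a set for
-- degree j − 1 in H with the edges at u removed. Finally 8 e(H) ≤ 8cn and 2^(2^(k−1) − 1) ≤ k^(2^(k−1)).

open import Defs hiding (sym; irrefl)

module FinSum where

  open import Data.Bool using (Bool; true; false; if_then_else_; _∧_; not)
  open import Data.Fin using (Fin; zero; suc; toℕ)
  open import Data.Fin.Properties using (_≟_)
  open import Relation.Binary.Definitions using (tri<; tri≈; tri>)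
  open import Relation.Nullary using (Dec; does; yes; no; ¬_)
  open import Relation.Nullary.Decidable using (dec-true; dec-false)
  import Data.Fin.Properties as Fin
  open import Data.List using (map; allFin; tabulate)
  open import Data.List.Properties using (map-tabulate)
  import Data.Nat.ListAction as List
  open import Data.Nat hiding (_≟_)
  open import Data.Nat using () renaming (_≟_ to _≟ℕ_)
  open import Data.Nat.Properties hiding (_≟_)
  open import Data.Product using (_×_; _,_; proj₁; proj₂)
  open import Data.Bool.Properties using (∧-conicalˡ; ∧-conicalʳ; ∧-zeroʳ; not-injective)
  open import Data.Nat.Tactic.RingSolver using (solve-∀)
  open import Data.Sum using (inj₁; inj₂)
  open import Data.Empty using (⊥-elim)
  open import Function using (id; _∘_)
  open import Relation.Binary.PropositionalEquality
  open import Algebra.Properties.Semiring.Sum +-*-semiring public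
    using (sum; sum-syntax; sum-cong-≗; ∑-distrib-+; ∑-comm; *-distribˡ-sum; *-distribʳ-sum)

  ⟦_⟧ : Bool → ℕ
  ⟦ b ⟧ = if b then 1 else 0

  ∣_∣ : ∀ {n} → (Fin n → Bool) → ℕ
  ∣_∣ {n} t = ∑[ i < n ] ⟦ t i ⟧

  InjectiveOn : ∀ {n} {A : Set} → (Fin n → A) → (Fin n → Bool) → Set
  InjectiveOn F t = ∀ i j → t i ≡ true → t j ≡ true → F i ≡ F j → i ≡ j

  listSum-allFin : ∀ {n} (f : Fin n → ℕ) → List.sum (map f (allFin n)) ≡ ∑[ i < n ] f i
  listSum-allFin f = trans (cong List.sum (map-tabulate id f)) (listSum-tabulate f)
    where
    listSum-tabulate : ∀ {n} (f : Fin n → ℕ) → List.sum (tabulate f) ≡ ∑[ i < n ] f i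
    listSum-tabulate {zero}  f = refl
    listSum-tabulate {suc n} f = cong (f zero +_) (listSum-tabulate (f ∘ suc))

  count≡∣∣ : ∀ {n} (p : Fin n → Bool) → count p ≡ ∣ p ∣
  count≡∣∣ p = listSum-allFin (⟦_⟧ ∘ p)

  ∑-mono-≤ : ∀ {n} {f g : Fin n → ℕ} → (∀ i → f i ≤ g i) → ∑[ i < n ] f i ≤ ∑[ i < n ] g i
  ∑-mono-≤ {zero}  f≤g = z≤n
  ∑-mono-≤ {suc n} f≤g = +-mono-≤ (f≤g zero) (∑-mono-≤ (f≤g ∘ suc))

  ≤-∑ : ∀ {n} (f : Fin n → ℕ) i → f i ≤ ∑[ j < n ] f j
  ≤-∑ f zero    = m≤m+n _ _
  ≤-∑ f (suc i) = ≤-trans (≤-∑ (f ∘ suc) i) (m≤n+m _ _)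

  ∑-const : ∀ n c → ∑[ i < n ] c ≡ n * c
  ∑-const zero    c = refl
  ∑-const (suc n) c = cong (c +_) (∑-const n c)

  ∑-zero : ∀ {n} {f : Fin n → ℕ} → (∀ i → f i ≡ 0) → ∑[ i < n ] f i ≡ 0
  ∑-zero {n} {f} f≡0 = trans (sum-cong-≗ f≡0) (trans (∑-const n 0) (*-zeroʳ n))

  _==_ : ∀ {n} → Fin n → Fin n → Bool
  i == j = does (i ≟ j)

  ==-refl : ∀ {n} (i : Fin n) → (i == i) ≡ true
  ==-refl i = dec-true (i ≟ i) refl

  ==-sym : ∀ {n} (i j : Fin n) → (i == j) ≡ (j == i)
  ==-sym i j with i ≟ j | j ≟ i
  ... | yes _   | yes _   = refl
  ... | no _    | no _    = refl
  ... | yes i≡j | no j≢i  = ⊥-elim (j≢i (sym i≡j))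
  ... | no i≢j  | yes j≡i = ⊥-elim (i≢j (sym j≡i))

  does⇒ : ∀ {a} {A : Set a} (d : Dec A) → does d ≡ true → A
  does⇒ (yes a) _ = a

  does⇏ : ∀ {a} {A : Set a} (d : Dec A) → does d ≡ false → ¬ A
  does⇏ (no ¬a) _ = ¬a

  ==⇒≡ : ∀ {n} {i j : Fin n} → (i == j) ≡ true → i ≡ j
  ==⇒≡ {i = i} {j} = does⇒ (i ≟ j)

  ≢⇒==-false : ∀ {n} {i j : Fin n} → i ≢ j → (i == j) ≡ false
  ≢⇒==-false {i = i} {j} = dec-false (i ≟ j)

  ∑-select : ∀ {n} (u : Fin n) (f : Fin n → ℕ) → ∑[ i < n ] (⟦ i == u ⟧ * f i) ≡ f u
  ∑-select {suc n} zero    f = trans (cong (f zero + 0 +_) (∑-zero {n} (λ _ → refl)))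
                                     (trans (+-identityʳ _) (+-identityʳ _))
  ∑-select {suc n} (suc u) f = ∑-select u (f ∘ suc)

  unique⇒∣∣≤1 : ∀ {n} (t : Fin n → Bool) → (∀ i j → t i ≡ true → t j ≡ true → i ≡ j) → ∣ t ∣ ≤ 1
  unique⇒∣∣≤1 {zero}  t unique = z≤n
  unique⇒∣∣≤1 {suc n} t unique with t zero in t0
  ... | true  = ≤-reflexive (cong suc (∑-zero rest-empty))
    where
    rest-empty : ∀ i → ⟦ t (suc i) ⟧ ≡ 0
    rest-empty i with t (suc i) in ti
    ... | false = refl
    ... | true  with () ← unique zero (suc i) t0 ti
  ... | false = unique⇒∣∣≤1 (t ∘ suc) (λ i j ti tj → Fin.suc-injective (unique (suc i) (suc j) ti tj))

  ∑∑-distrib-+ : ∀ {m n} (f g : Fin m → Fin n → ℕ) →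
    ∑[ i < m ] ∑[ j < n ] (f i j + g i j) ≡ ∑[ i < m ] ∑[ j < n ] f i j + ∑[ i < m ] ∑[ j < n ] g i j
  ∑∑-distrib-+ {m} {n} f g = trans (sum-cong-≗ (λ i → ∑-distrib-+ (f i) (g i)))
    (∑-distrib-+ (λ i → ∑[ j < n ] f i j) (λ i → ∑[ j < n ] g i j))

  pairCount : ∀ {n} → (Fin n → Fin n → Bool) → ℕ
  pairCount {n} p = List.sum (map (λ a → count (λ b → (toℕ a <ᵇ toℕ b) ∧ p a b)) (allFin n))

  2*pairCount : ∀ {n} (p : Fin n → Fin n → Bool) → (∀ a b → p a b ≡ p b a) → (∀ a → p a a ≡ false) →
    2 * pairCount p ≡ ∑[ a < n ] ∑[ b < n ] ⟦ p a b ⟧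
  2*pairCount {n} p p-sym p-irrefl = begin
    2 * pairCount p
      ≡⟨ cong (2 *_) (trans (listSum-allFin (count ∘ pairsFrom)) (sum-cong-≗ (count≡∣∣ ∘ pairsFrom))) ⟩
    2 * X
      ≡⟨ cong (X +_) (+-identityʳ X) ⟩
    X + X
      ≡⟨ cong (X +_) (∑-comm (λ b a → below b a)) ⟩
    X + ∑[ a < n ] ∑[ b < n ] below b a
      ≡⟨ sym (∑∑-distrib-+ below (λ a b → below b a)) ⟩
    ∑[ a < n ] ∑[ b < n ] (below a b + below b a)
      ≡⟨ sym (sum-cong-≗ (λ a → sum-cong-≗ (split a))) ⟩
    ∑[ a < n ] ∑[ b < n ] ⟦ p a b ⟧ ∎
    where
    open ≡-Reasoning
    pairsFrom : Fin n → Fin n → Bool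
    pairsFrom a b = (toℕ a <ᵇ toℕ b) ∧ p a b
    below : Fin n → Fin n → ℕ
    below a b = ⟦ pairsFrom a b ⟧
    X = ∑[ a < n ] ∑[ b < n ] below a b
    split : ∀ a b → ⟦ p a b ⟧ ≡ below a b + below b a
    split a b with <-cmp (toℕ a) (toℕ b)
    ... | tri< a<b _ b≮a rewrite dec-true (toℕ a <? toℕ b) a<b | dec-false (toℕ b <? toℕ a) b≮a = sym (+-identityʳ _)
    ... | tri> a≮b _ b<a rewrite dec-false (toℕ a <? toℕ b) a≮b | dec-true (toℕ b <? toℕ a) b<a = cong ⟦_⟧ (p-sym a b)
    ... | tri≈ _ a≡b _ with refl ← Fin.toℕ-injective a≡b rewrite p-irrefl a | ∧-zeroʳ (toℕ a <ᵇ toℕ a) = refl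

  ∑-split : ∀ {n} (t s : Fin n → Bool) (f : Fin n → ℕ) →
            ∑[ i < n ] (⟦ t i ⟧ * f i) ≡ ∑[ i < n ] (⟦ t i ∧ not (s i) ⟧ * f i) + ∑[ i < n ] (⟦ t i ∧ s i ⟧ * f i)
  ∑-split t s f = trans (sum-cong-≗ split) (∑-distrib-+ (λ i → ⟦ t i ∧ not (s i) ⟧ * f i) (λ i → ⟦ t i ∧ s i ⟧ * f i))
    where
    split : ∀ i → ⟦ t i ⟧ * f i ≡ ⟦ t i ∧ not (s i) ⟧ * f i + ⟦ t i ∧ s i ⟧ * f i
    split i with t i | s i
    ... | false | _     = refl
    ... | true  | false = sym (+-identityʳ _)
    ... | true  | true  = refl

  ∣∣-split : ∀ {n} (t s : Fin n → Bool) → ∣ t ∣ ≡ ∣ (λ i → t i ∧ not (s i)) ∣ + ∣ (λ i → t i ∧ s i) ∣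
  ∣∣-split {n} t s = begin
    ∣ t ∣
      ≡⟨ sum-cong-≗ (λ i → sym (*-identityʳ ⟦ t i ⟧)) ⟩
    ∑[ i < n ] (⟦ t i ⟧ * 1)
      ≡⟨ ∑-split t s (λ _ → 1) ⟩
    ∑[ i < n ] (⟦ t i ∧ not (s i) ⟧ * 1) + ∑[ i < n ] (⟦ t i ∧ s i ⟧ * 1)
      ≡⟨ cong₂ _+_ (sum-cong-≗ (λ i → *-identityʳ ⟦ t i ∧ not (s i) ⟧)) (sum-cong-≗ (λ i → *-identityʳ ⟦ t i ∧ s i ⟧)) ⟩
    ∣ (λ i → t i ∧ not (s i)) ∣ + ∣ (λ i → t i ∧ s i) ∣ ∎
    where open ≡-Reasoning

  triangular-step : ∀ {m z S L} → m ≤ L → z ≤ 1 → m * suc m ≤ 2 * S →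
                    m + z ≤ suc L × (m + z) * suc (m + z) ≤ 2 * (S + z * suc L)
  triangular-step {m} {S = S} m≤L z≤n m[m+1]≤2S =
    subst (_≤ _) (sym (+-identityʳ m)) (m≤n⇒m≤1+n m≤L) ,
    subst₂ (λ a b → a * suc a ≤ 2 * b) (sym (+-identityʳ m)) (sym (+-identityʳ S)) m[m+1]≤2S
  triangular-step {m} {S = S} {L} m≤L (s≤s z≤n) m[m+1]≤2S =
    subst (_≤ suc L) (+-comm 1 m) (s≤s m≤L) ,
    subst₂ _≤_ (square-step m) (sum-step S L) (+-mono-≤ m[m+1]≤2S (*-monoʳ-≤ 2 (s≤s m≤L)))
    where
    square-step : ∀ m → m * suc m + 2 * suc m ≡ (m + 1) * suc (m + 1)
    square-step = solve-∀
    sum-step : ∀ S L → 2 * S + 2 * suc L ≡ 2 * (S + 1 * suc L)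
    sum-step = solve-∀

  -- Induct on L, splitting off the (at most one) element with value L.
  ∑-distinct-bounded : ∀ {n} L (t : Fin n → Bool) (F : Fin n → ℕ) → InjectiveOn F t →
    (∀ i → t i ≡ true → 0 < F i × F i ≤ L) →
    ∣ t ∣ ≤ L × ∣ t ∣ * suc ∣ t ∣ ≤ 2 * ∑[ i < n ] (⟦ t i ⟧ * F i)
  ∑-distinct-bounded {n} zero t F F-inj F-range = subst P (sym (∑-zero t-empty)) (z≤n , z≤n)
    where
    P : ℕ → Set
    P m = m ≤ 0 × m * suc m ≤ 2 * ∑[ i < n ] (⟦ t i ⟧ * F i)
    t-empty : ∀ i → ⟦ t i ⟧ ≡ 0
    t-empty i with t i in ti
    ... | false = refl
    ... | true with () ← ≤-trans (proj₁ (F-range i ti)) (proj₂ (F-range i ti))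
  ∑-distinct-bounded {n} (suc L) t F F-inj F-range =
    subst₂ (λ m S → m ≤ suc L × m * suc m ≤ 2 * S) (sym (∣∣-split t top)) (sym weight-split)
      (triangular-step {S = S-below} (proj₁ below-bound) ∣atTop∣≤1 (proj₂ below-bound))
    where
    top below atTop : Fin n → Bool
    top i   = does (F i ≟ℕ suc L)
    below i = t i ∧ not (top i)
    atTop i = t i ∧ top i
    S-below = ∑[ i < n ] (⟦ below i ⟧ * F i)

    below-range : ∀ i → below i ≡ true → 0 < F i × F i ≤ L
    below-range i bi with F-range i (∧-conicalˡ _ _ bi)
    ... | 0<F , F≤1+L = 0<F , s≤s⁻¹ (≤∧≢⇒< F≤1+L (does⇏ (F i ≟ℕ suc L) (not-injective (∧-conicalʳ _ _ bi))))
    below-bound : ∣ below ∣ ≤ L × ∣ below ∣ * suc ∣ below ∣ ≤ 2 * S-below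
    below-bound = ∑-distinct-bounded L below F
      (λ i j bi bj → F-inj i j (∧-conicalˡ _ _ bi) (∧-conicalˡ _ _ bj)) below-range

    F≡top : ∀ i → atTop i ≡ true → F i ≡ suc L
    F≡top i ai = does⇒ (F i ≟ℕ suc L) (∧-conicalʳ _ _ ai)
    ∣atTop∣≤1 : ∣ atTop ∣ ≤ 1
    ∣atTop∣≤1 = unique⇒∣∣≤1 atTop (λ i j ai aj →
      F-inj i j (∧-conicalˡ _ _ ai) (∧-conicalˡ _ _ aj) (trans (F≡top i ai) (sym (F≡top j aj))))
    top-weight : ∀ i → ⟦ atTop i ⟧ * F i ≡ ⟦ atTop i ⟧ * suc L
    top-weight i with atTop i in ai
    ... | true  = cong (_+ 0) (F≡top i ai)
    ... | false = refl
    weight-split : ∑[ i < n ] (⟦ t i ⟧ * F i) ≡ S-below + ∣ atTop ∣ * suc L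
    weight-split = trans (∑-split t top F)
      (cong (S-below +_) (trans (sum-cong-≗ top-weight) (sym (*-distribʳ-sum (suc L) (⟦_⟧ ∘ atTop)))))

  ∑-distinct-positive : ∀ {n} (t : Fin n → Bool) (F : Fin n → ℕ) → InjectiveOn F t →
    (∀ i → t i ≡ true → 0 < F i) →
    ∣ t ∣ * suc ∣ t ∣ ≤ 2 * ∑[ i < n ] (⟦ t i ⟧ * F i)
  ∑-distinct-positive {n} t F F-inj F-pos =
    proj₂ (∑-distinct-bounded (∑[ i < n ] (⟦ t i ⟧ * F i)) t F F-inj (λ i ti → F-pos i ti , ≤-weight i ti))
    where
    ≤-weight : ∀ i → t i ≡ true → F i ≤ ∑[ j < n ] (⟦ t j ⟧ * F j)
    ≤-weight i ti = subst (_≤ ∑[ j < n ] (⟦ t j ⟧ * F j)) (trans (cong (λ b → ⟦ b ⟧ * F i) ti) (+-identityʳ (F i)))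
                          (≤-∑ (λ j → ⟦ t j ⟧ * F j) i)

  maximum : ∀ {n} → (Fin n → ℕ) → ℕ
  maximum {zero}  f = 0
  maximum {suc n} f = f zero ⊔ maximum (f ∘ suc)

  ≤-maximum : ∀ {n} (f : Fin n → ℕ) i → f i ≤ maximum f
  ≤-maximum f zero    = m≤m⊔n _ _
  ≤-maximum f (suc i) = ≤-trans (≤-maximum (f ∘ suc) i) (m≤n⊔m _ _)

  maximum-preserves : ∀ {n} (P : ℕ → Set) (f : Fin n → ℕ) → P 0 → (∀ i → P (f i)) → P (maximum f)
  maximum-preserves {zero}  P f P0 Pf = P0
  maximum-preserves {suc n} P f P0 Pf with ⊔-sel (f zero) (maximum (f ∘ suc))
  ... | inj₁ eq = subst P (sym eq) (Pf zero)
  ... | inj₂ eq = subst P (sym eq) (maximum-preserves P (f ∘ suc) P0 (Pf ∘ suc))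


module ArcsNear where

  open import Data.Bool using (Bool; true; false; _∧_; _∨_; not)
  open import Data.Bool.Properties using (∧-conicalˡ; ∧-conicalʳ; ∧-identityʳ; ∧-comm; ∨-zeroʳ)
  open import Data.Fin using (Fin)
  open import Data.Nat
  open import Data.Nat.Properties
  open import Function using (_∘_)
  open import Data.Nat.Tactic.RingSolver using (solve-∀)
  open import Algebra.Properties.CommutativeSemigroup *-commutativeSemigroup using (x∙yz≈y∙xz)
  open import Relation.Binary.PropositionalEquality
  open FinSum
  open Graph using () renaming (sym to adj-sym; irrefl to adj-irrefl)

  module _ {n : ℕ} (H : Graph n) where

    deg : Fin n → ℕ
    deg v = ∑[ u < n ] ⟦ adj H v u ⟧

    degreeSum : ℕ
    degreeSum = ∑[ v < n ] deg v

    closedNbhd : Fin n → Fin n → Bool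
    closedNbhd v a = (a == v) ∨ adj H v a

    arcsNear : Fin n → ℕ
    arcsNear v = ∑[ a < n ] ∑[ b < n ] ⟦ adj H a b ∧ (closedNbhd v a ∨ closedNbhd v b) ⟧

    neighbourDegreeSum : Fin n → ℕ
    neighbourDegreeSum v = ∑[ u < n ] (⟦ adj H v u ⟧ * deg u)

    adj⇒≢ : ∀ {u v} → adj H u v ≡ true → u ≢ v
    adj⇒≢ {u} huv refl with () ← trans (sym huv) (adj-irrefl H u)

    deg≤arcsNear : ∀ v → deg v ≤ arcsNear v
    deg≤arcsNear v = subst (_≤ arcsNear v) (sum-cong-≗ row-v) (≤-∑ (λ a → ∑[ b < n ] arc a b) v)
      where
      arc : Fin n → Fin n → ℕ
      arc a b = ⟦ adj H a b ∧ (closedNbhd v a ∨ closedNbhd v b) ⟧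
      row-v : ∀ b → arc v b ≡ ⟦ adj H v b ⟧
      row-v b rewrite ==-refl v = cong ⟦_⟧ (∧-identityʳ (adj H v b))

    private
      near-arc : ∀ e p x q y → (e ≡ true → p ≡ true → y ≡ true) → (e ≡ true → q ≡ true → x ≡ true) →
                 ⟦ e ∧ ((p ∨ x) ∨ (q ∨ y)) ⟧ ≤ ⟦ x ⟧ * ⟦ e ⟧ + ⟦ y ⟧ * ⟦ e ⟧
      near-arc false _     _     _     _     _   _   = z≤n
      near-arc true  true  true  _     true  _   _   = s≤s z≤n
      near-arc true  true  false _     true  _   _   = s≤s z≤n
      near-arc true  true  _     _     false p⇒y _   with () ← p⇒y refl refl
      near-arc true  false true  _     _     _   _   = s≤s z≤n
      near-arc true  false false true  _     _   q⇒x with () ← q⇒x refl refl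
      near-arc true  false false false true  _   _   = s≤s z≤n
      near-arc true  false false false false _   _   = z≤n

    -- An edge meeting N[v] has an endpoint adjacent to v, so it is counted in the degree of a neighbour of v.
    arcsNear≤2*neighbourDegreeSum : ∀ v → arcsNear v ≤ 2 * neighbourDegreeSum v
    arcsNear≤2*neighbourDegreeSum v = begin
      arcsNear v
        ≤⟨ ∑-mono-≤ (λ a → ∑-mono-≤ (λ b → near-arc (adj H a b) (a == v) (adj H v a) (b == v) (adj H v b)
                                             (a=v⇒v~b a b) (b=v⇒v~a a b))) ⟩
      ∑[ a < n ] ∑[ b < n ] (⟦ adj H v a ⟧ * ⟦ adj H a b ⟧ + ⟦ adj H v b ⟧ * ⟦ adj H a b ⟧)
        ≡⟨ ∑∑-distrib-+ (λ a b → ⟦ adj H v a ⟧ * ⟦ adj H a b ⟧) (λ a b → ⟦ adj H v b ⟧ * ⟦ adj H a b ⟧) ⟩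
      ∑[ a < n ] ∑[ b < n ] (⟦ adj H v a ⟧ * ⟦ adj H a b ⟧) + ∑[ a < n ] ∑[ b < n ] (⟦ adj H v b ⟧ * ⟦ adj H a b ⟧)
        ≡⟨ cong₂ _+_ first-endpoint second-endpoint ⟩
      neighbourDegreeSum v + neighbourDegreeSum v
        ≡⟨ cong (neighbourDegreeSum v +_) (sym (+-identityʳ _)) ⟩
      2 * neighbourDegreeSum v ∎
      where
      open ≤-Reasoning
      a=v⇒v~b : ∀ a b → adj H a b ≡ true → (a == v) ≡ true → adj H v b ≡ true
      a=v⇒v~b a b a~b a=v = subst (λ x → adj H x b ≡ true) (==⇒≡ a=v) a~b
      b=v⇒v~a : ∀ a b → adj H a b ≡ true → (b == v) ≡ true → adj H v a ≡ true
      b=v⇒v~a a b a~b b=v = subst (λ x → adj H x a ≡ true) (==⇒≡ b=v) (trans (adj-sym H b a) a~b)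
      first-endpoint : ∑[ a < n ] ∑[ b < n ] (⟦ adj H v a ⟧ * ⟦ adj H a b ⟧) ≡ neighbourDegreeSum v
      first-endpoint = sum-cong-≗ (λ a → sym (*-distribˡ-sum ⟦ adj H v a ⟧ (λ b → ⟦ adj H a b ⟧)))
      second-endpoint : ∑[ a < n ] ∑[ b < n ] (⟦ adj H v b ⟧ * ⟦ adj H a b ⟧) ≡ neighbourDegreeSum v
      second-endpoint = trans (∑-comm (λ a b → ⟦ adj H v b ⟧ * ⟦ adj H a b ⟧))
        (sum-cong-≗ (λ b → trans (sym (*-distribˡ-sum ⟦ adj H v b ⟧ (λ a → ⟦ adj H a b ⟧)))
                                  (cong (⟦ adj H v b ⟧ *_) (sum-cong-≗ (λ a → cong ⟦_⟧ (adj-sym H a b))))))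

  isolate : ∀ {n} → Graph n → Fin n → Graph n
  isolate H u = record
    { adj    = λ a b → adj H a b ∧ (not (a == u) ∧ not (b == u))
    ; sym    = λ a b → cong₂ _∧_ (adj-sym H a b) (∧-comm (not (a == u)) (not (b == u)))
    ; irrefl = λ a → cong (_∧ _) (adj-irrefl H a)
    }

  degreeSum-isolate-≤ : ∀ {n} (H : Graph n) u → degreeSum (isolate H u) ≤ degreeSum H
  degreeSum-isolate-≤ H u = ∑-mono-≤ (λ v → ∑-mono-≤ (λ b → ⟦∧⟧-≤ (adj H v b) _))
    where
    ⟦∧⟧-≤ : ∀ x y → ⟦ x ∧ y ⟧ ≤ ⟦ x ⟧
    ⟦∧⟧-≤ true  true  = ≤-refl
    ⟦∧⟧-≤ true  false = z≤n
    ⟦∧⟧-≤ false _     = z≤n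

  module _ {n : ℕ} (H : Graph n) {u v : Fin n} (u~v : adj H u v ≡ true) where

    private
      v~u : adj H v u ≡ true
      v~u = trans (adj-sym H v u) u~v
      v≠u : (v == u) ≡ false
      v≠u = ≢⇒==-false (adj⇒≢ H v~u)

      drop-u : ∀ x q → (q ≡ true → x ≡ true) → ⟦ x ⟧ ≡ ⟦ x ∧ (not false ∧ not q) ⟧ + ⟦ q ⟧ * 1
      drop-u true  false _   = refl
      drop-u false false _   = refl
      drop-u true  true  _   = refl
      drop-u false true  q⇒x with () ← q⇒x refl

      arc-split : ∀ e Na Nb Na′ Nb′ p q → (p ≡ true → Na ≡ true) → (q ≡ true → Nb ≡ true) →
        (p ≡ false → Na′ ≡ Na) → (q ≡ false → Nb′ ≡ Nb) → (p ≡ true → q ≡ true → e ≡ false) →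
        ⟦ e ∧ (Na ∨ Nb) ⟧ ≡ ⟦ (e ∧ (not p ∧ not q)) ∧ (Na′ ∨ Nb′) ⟧ + (⟦ p ⟧ * ⟦ e ⟧ + ⟦ q ⟧ * ⟦ e ⟧)
      arc-split e     Na Nb Na′ Nb′ true  true  _    _    _    _    pq⇒¬e rewrite pq⇒¬e refl refl = refl
      arc-split false Na Nb Na′ Nb′ true  false _    _    _    _    _ = refl
      arc-split true  Na Nb Na′ Nb′ true  false p⇒Na _    _    _    _ rewrite p⇒Na refl = refl
      arc-split false Na Nb Na′ Nb′ false true  _    _    _    _    _ = refl
      arc-split true  Na Nb Na′ Nb′ false true  _    q⇒Nb _    _    _ rewrite q⇒Nb refl | ∨-zeroʳ Na = refl
      arc-split false Na Nb Na′ Nb′ false false _    _    _    _    _ = refl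
      arc-split true  Na Nb Na′ Nb′ false false _    _    Na′≡ Nb′≡ _ rewrite Na′≡ refl | Nb′≡ refl = sym (+-identityʳ _)

      u∈N[v] : ∀ {a} → (a == u) ≡ true → closedNbhd H v a ≡ true
      u∈N[v] a=u = subst (λ x → closedNbhd H v x ≡ true) (sym (==⇒≡ a=u)) (trans (cong ((u == v) ∨_) v~u) (∨-zeroʳ (u == v)))

      N[v]-isolate : ∀ {a} → (a == u) ≡ false → closedNbhd (isolate H u) v a ≡ closedNbhd H v a
      N[v]-isolate {a} a≠u rewrite v≠u | a≠u = cong ((a == v) ∨_) (∧-identityʳ (adj H v a))

    deg-isolate : deg H v ≡ suc (deg (isolate H u) v)
    deg-isolate = begin
      deg H v
        ≡⟨ sum-cong-≗ split ⟩
      ∑[ b < n ] (⟦ adj (isolate H u) v b ⟧ + ⟦ b == u ⟧ * 1)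
        ≡⟨ ∑-distrib-+ (λ b → ⟦ adj (isolate H u) v b ⟧) (λ b → ⟦ b == u ⟧ * 1) ⟩
      deg (isolate H u) v + ∑[ b < n ] (⟦ b == u ⟧ * 1)
        ≡⟨ cong (deg (isolate H u) v +_) (∑-select u (λ _ → 1)) ⟩
      deg (isolate H u) v + 1
        ≡⟨ +-comm _ 1 ⟩
      suc (deg (isolate H u) v) ∎
      where
      open ≡-Reasoning
      split : ∀ b → ⟦ adj H v b ⟧ ≡ ⟦ adj (isolate H u) v b ⟧ + ⟦ b == u ⟧ * 1
      split b rewrite v≠u = drop-u (adj H v b) (b == u) (λ b=u → subst (λ x → adj H v x ≡ true) (sym (==⇒≡ b=u)) v~u)

    arcsNear-isolate : arcsNear H v ≡ arcsNear (isolate H u) v + 2 * deg H u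
    arcsNear-isolate = begin
      arcsNear H v
        ≡⟨ sum-cong-≗ (λ a → sum-cong-≗ (λ b → split a b)) ⟩
      ∑[ a < n ] ∑[ b < n ] (arc′ a b + (from-u a b + to-u a b))
        ≡⟨ ∑∑-distrib-+ arc′ (λ a b → from-u a b + to-u a b) ⟩
      arcsNear (isolate H u) v + ∑[ a < n ] ∑[ b < n ] (from-u a b + to-u a b)
        ≡⟨ cong (arcsNear (isolate H u) v +_) (trans (∑∑-distrib-+ from-u to-u) (cong₂ _+_ ∑∑from-u ∑∑to-u)) ⟩
      arcsNear (isolate H u) v + (deg H u + deg H u)
        ≡⟨ cong (λ d → arcsNear (isolate H u) v + (deg H u + d)) (sym (+-identityʳ _)) ⟩
      arcsNear (isolate H u) v + 2 * deg H u ∎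
      where
      open ≡-Reasoning
      arc′ from-u to-u : Fin n → Fin n → ℕ
      arc′ a b = ⟦ adj (isolate H u) a b ∧ (closedNbhd (isolate H u) v a ∨ closedNbhd (isolate H u) v b) ⟧
      from-u a b = ⟦ a == u ⟧ * ⟦ adj H a b ⟧
      to-u a b = ⟦ b == u ⟧ * ⟦ adj H a b ⟧
      split : ∀ a b → ⟦ adj H a b ∧ (closedNbhd H v a ∨ closedNbhd H v b) ⟧ ≡ arc′ a b + (from-u a b + to-u a b)
      split a b = arc-split (adj H a b) _ _ _ _ (a == u) (b == u)
        (u∈N[v] {a}) (u∈N[v] {b}) (N[v]-isolate {a}) (N[v]-isolate {b})
        (λ a=u b=u → trans (cong₂ (adj H) (==⇒≡ a=u) (==⇒≡ b=u)) (adj-irrefl H u))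
      ∑∑from-u : ∑[ a < n ] ∑[ b < n ] from-u a b ≡ deg H u
      ∑∑from-u = trans (sum-cong-≗ (λ a → sym (*-distribˡ-sum ⟦ a == u ⟧ (λ b → ⟦ adj H a b ⟧)))) (∑-select u (deg H))
      ∑∑to-u : ∑[ a < n ] ∑[ b < n ] to-u a b ≡ deg H u
      ∑∑to-u = begin
        ∑[ a < n ] ∑[ b < n ] to-u a b
          ≡⟨ ∑-comm to-u ⟩
        ∑[ b < n ] ∑[ a < n ] to-u a b
          ≡⟨ sum-cong-≗ (λ b → sym (*-distribˡ-sum ⟦ b == u ⟧ (λ a → ⟦ adj H a b ⟧))) ⟩
        ∑[ b < n ] (⟦ b == u ⟧ * ∑[ a < n ] ⟦ adj H a b ⟧)
          ≡⟨ ∑-select u (λ b → ∑[ a < n ] ⟦ adj H a b ⟧) ⟩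
        ∑[ a < n ] ⟦ adj H a u ⟧
          ≡⟨ sum-cong-≗ (λ a → cong ⟦_⟧ (adj-sym H a u)) ⟩
        deg H u ∎

  neighboursIn : ∀ {n} → Graph n → (Fin n → Bool) → Fin n → Fin n → Bool
  neighboursIn H t u v = t v ∧ adj H u v

  ∑-neighbourDegreeSum-≤ : ∀ {n} (H : Graph n) (t : Fin n → Bool) →
    ∑[ v < n ] (⟦ t v ⟧ * neighbourDegreeSum H v) ≤ degreeSum H * maximum (λ u → ∣ neighboursIn H t u ∣)
  ∑-neighbourDegreeSum-≤ {n} H t = begin
    ∑[ v < n ] (⟦ t v ⟧ * neighbourDegreeSum H v)
      ≡⟨ sum-cong-≗ (λ v → trans (*-distribˡ-sum ⟦ t v ⟧ (λ u → ⟦ adj H v u ⟧ * deg H u)) (sum-cong-≗ (in-t v))) ⟩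
    ∑[ v < n ] ∑[ u < n ] (⟦ neighboursIn H t u v ⟧ * deg H u)
      ≡⟨ ∑-comm (λ v u → ⟦ neighboursIn H t u v ⟧ * deg H u) ⟩
    ∑[ u < n ] ∑[ v < n ] (⟦ neighboursIn H t u v ⟧ * deg H u)
      ≡⟨ sum-cong-≗ (λ u → sym (*-distribʳ-sum (deg H u) (⟦_⟧ ∘ neighboursIn H t u))) ⟩
    ∑[ u < n ] (∣ neighboursIn H t u ∣ * deg H u)
      ≤⟨ ∑-mono-≤ (λ u → *-monoˡ-≤ (deg H u) (≤-maximum (λ u → ∣ neighboursIn H t u ∣) u)) ⟩
    ∑[ u < n ] (R * deg H u)
      ≡⟨ sym (*-distribˡ-sum R (deg H)) ⟩
    R * degreeSum H
      ≡⟨ *-comm R _ ⟩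
    degreeSum H * R ∎
    where
    open ≤-Reasoning
    R = maximum (λ u → ∣ neighboursIn H t u ∣)
    in-t : ∀ v u → ⟦ t v ⟧ * (⟦ adj H v u ⟧ * deg H u) ≡ ⟦ neighboursIn H t u v ⟧ * deg H u
    in-t v u with t v
    ... | false = refl
    ... | true  = trans (+-identityʳ _) (cong (λ b → ⟦ b ⟧ * deg H u) (adj-sym H v u))

  distinctArcsNear-square-bound : ∀ {n} (H : Graph n) (t : Fin n → Bool) → InjectiveOn (arcsNear H) t →
    (∀ v → t v ≡ true → 0 < deg H v) →
    ∣ t ∣ ^ 2 ≤ 4 * degreeSum H * maximum (λ u → ∣ neighboursIn H t u ∣)
  distinctArcsNear-square-bound {n} H t arcs-inj deg-pos = begin
    m * (m * 1)
      ≤⟨ *-monoʳ-≤ m (≤-trans (≤-reflexive (*-identityʳ m)) (n≤1+n m)) ⟩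
    m * suc m
      ≤⟨ ∑-distinct-positive t (arcsNear H) arcs-inj arcs-pos ⟩
    2 * ∑[ v < n ] (⟦ t v ⟧ * arcsNear H v)
      ≤⟨ *-monoʳ-≤ 2 (∑-mono-≤ arcs≤) ⟩
    2 * ∑[ v < n ] (2 * (⟦ t v ⟧ * neighbourDegreeSum H v))
      ≡⟨ cong (2 *_) (sym (*-distribˡ-sum 2 (λ v → ⟦ t v ⟧ * neighbourDegreeSum H v))) ⟩
    2 * (2 * ∑[ v < n ] (⟦ t v ⟧ * neighbourDegreeSum H v))
      ≤⟨ *-monoʳ-≤ 2 (*-monoʳ-≤ 2 (∑-neighbourDegreeSum-≤ H t)) ⟩
    2 * (2 * (degreeSum H * R))
      ≡⟨ regroup (degreeSum H) R ⟩
    4 * degreeSum H * R ∎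
    where
    open ≤-Reasoning
    m = ∣ t ∣
    R = maximum (λ u → ∣ neighboursIn H t u ∣)
    arcs-pos : ∀ v → t v ≡ true → 0 < arcsNear H v
    arcs-pos v tv = ≤-trans (deg-pos v tv) (deg≤arcsNear H v)
    arcs≤ : ∀ v → ⟦ t v ⟧ * arcsNear H v ≤ 2 * (⟦ t v ⟧ * neighbourDegreeSum H v)
    arcs≤ v = ≤-trans (*-monoʳ-≤ ⟦ t v ⟧ (arcsNear≤2*neighbourDegreeSum H v))
                      (≤-reflexive (x∙yz≈y∙xz ⟦ t v ⟧ 2 (neighbourDegreeSum H v)))
    regroup : ∀ D R → 2 * (2 * (D * R)) ≡ 4 * D * R
    regroup = solve-∀

  ^-distribʳ-* : ∀ a b r → (a * b) ^ r ≡ a ^ r * b ^ r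
  ^-distribʳ-* a b zero    = refl
  ^-distribʳ-* a b (suc r) = trans (cong (a * b *_) (^-distribʳ-* a b r)) (lemma a b (a ^ r) (b ^ r))
    where
    lemma : ∀ a b x y → a * b * (x * y) ≡ a * x * (b * y)
    lemma = solve-∀

  ^-double-step : ∀ {m Y R} P → 0 < P → m ^ 2 ≤ Y * R → R ^ P ≤ Y ^ (P ∸ 1) → m ^ (2 * P) ≤ Y ^ (2 * P ∸ 1)
  ^-double-step {m} {Y} {R} P 0<P m²≤YR Rᴾ≤ = begin
    m ^ (2 * P)           ≡⟨ sym (^-*-assoc m 2 P) ⟩
    (m ^ 2) ^ P           ≤⟨ ^-monoˡ-≤ P m²≤YR ⟩
    (Y * R) ^ P           ≡⟨ ^-distribʳ-* Y R P ⟩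
    Y ^ P * R ^ P         ≤⟨ *-monoʳ-≤ (Y ^ P) Rᴾ≤ ⟩
    Y ^ P * Y ^ (P ∸ 1)   ≡⟨ sym (^-distribˡ-+-* Y P (P ∸ 1)) ⟩
    Y ^ (P + (P ∸ 1))     ≡⟨ cong (Y ^_) exponent ⟩
    Y ^ (2 * P ∸ 1)       ∎
    where
    open ≤-Reasoning
    exponent : P + (P ∸ 1) ≡ 2 * P ∸ 1
    exponent = trans (sym (+-∸-assoc P 0<P)) (cong (λ x → P + x ∸ 1) (sym (+-identityʳ P)))

  -- In isolate H u the neighbours of u in t have degree j and uniformly shifted arcsNear, so induction applies to them.
  distinctArcsNear-bound : ∀ j {n} (H : Graph n) (t : Fin n → Bool) →
    (∀ v → t v ≡ true → deg H v ≡ j) → InjectiveOn (arcsNear H) t →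
    ∣ t ∣ ^ (2 ^ j) ≤ (4 * degreeSum H) ^ (2 ^ j ∸ 1)
  distinctArcsNear-bound zero {n} H t deg≡0 arcs-inj =
    subst (_≤ 1) (sym (*-identityʳ ∣ t ∣))
      (unique⇒∣∣≤1 t (λ v w tv tw → arcs-inj v w tv tw (trans (arcs≡0 v tv) (sym (arcs≡0 w tw)))))
    where
    arcs≡0 : ∀ v → t v ≡ true → arcsNear H v ≡ 0
    arcs≡0 v tv = n≤0⇒n≡0 (≤-trans (arcsNear≤2*neighbourDegreeSum H v) (≤-reflexive (cong (2 *_) (∑-zero no-nbr))))
      where
      no-nbr : ∀ u → ⟦ adj H v u ⟧ * deg H u ≡ 0
      no-nbr u = cong (_* deg H u) (n≤0⇒n≡0 (subst (⟦ adj H v u ⟧ ≤_) (deg≡0 v tv) (≤-∑ (λ u → ⟦ adj H v u ⟧) u)))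
  distinctArcsNear-bound (suc j) {n} H t deg≡1+j arcs-inj =
    ^-double-step P (m^n>0 2 j) (distinctArcsNear-square-bound H t arcs-inj deg-pos) Rᴾ≤Yᴾ⁻¹
    where
    P = 2 ^ j
    Y = 4 * degreeSum H

    deg-pos : ∀ v → t v ≡ true → 0 < deg H v
    deg-pos v tv = subst (0 <_) (sym (deg≡1+j v tv)) (s≤s z≤n)

    neighbours-bound : ∀ u → ∣ neighboursIn H t u ∣ ^ P ≤ Y ^ (P ∸ 1)
    neighbours-bound u = ≤-trans (distinctArcsNear-bound j (isolate H u) (neighboursIn H t u) deg≡j inj)
                                 (^-monoˡ-≤ (P ∸ 1) (*-monoʳ-≤ 4 (degreeSum-isolate-≤ H u)))
      where
      deg≡j : ∀ v → neighboursIn H t u v ≡ true → deg (isolate H u) v ≡ j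
      deg≡j v tv = suc-injective (trans (sym (deg-isolate H (∧-conicalʳ _ _ tv))) (deg≡1+j v (∧-conicalˡ _ _ tv)))
      inj : InjectiveOn (arcsNear (isolate H u)) (neighboursIn H t u)
      inj v w tv tw eq = arcs-inj v w (∧-conicalˡ _ _ tv) (∧-conicalˡ _ _ tw)
        (trans (arcsNear-isolate H (∧-conicalʳ _ _ tv))
          (trans (cong (_+ 2 * deg H u) eq) (sym (arcsNear-isolate H (∧-conicalʳ _ _ tw)))))

    Rᴾ≤Yᴾ⁻¹ : maximum (λ u → ∣ neighboursIn H t u ∣) ^ P ≤ Y ^ (P ∸ 1)
    Rᴾ≤Yᴾ⁻¹ = maximum-preserves (λ r → r ^ P ≤ Y ^ (P ∸ 1)) (λ u → ∣ neighboursIn H t u ∣) 0ᴾ≤ neighbours-bound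
      where
      0ᴾ≤ : 0 ^ P ≤ Y ^ (P ∸ 1)
      0ᴾ≤ with P | m^n>0 2 j
      ... | suc _ | _ = z≤n


module Complement where

  open import Data.Bool using (Bool; true; false; _∧_; _∨_; not)
  open import Data.Bool.Properties using (∧-zeroʳ)
  open import Data.Fin using (Fin)
  open import Data.Fin.Properties using (_≟_)
  open import Data.Nat hiding (_≟_)
  open import Data.Nat using () renaming (_≟_ to _≟ℕ_)
  open import Relation.Nullary using (yes; no)
  open import Data.Nat.Combinatorics using (_C_; nC1≡n; nCk+nC[k+1]≡[n+1]C[k+1])
  open import Data.Nat.Properties hiding (_≟_)
  open import Data.Nat.Tactic.RingSolver using (solve-∀)
  open import Relation.Binary.PropositionalEquality
  open import Algebra.Properties.CommutativeSemigroup +-commutativeSemigroup using (xy∙z≈xz∙y)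
  open FinSum
  open ArcsNear
  open Graph using () renaming (sym to adj-sym; irrefl to adj-irrefl)

  complement : ∀ {n} → Graph n → Graph n
  complement G = record
    { adj    = λ a b → not (a == b) ∧ not (adj G a b)
    ; sym    = λ a b → cong₂ (λ x y → not x ∧ not y) (==-sym a b) (adj-sym G a b)
    ; irrefl = λ a → cong (λ x → not x ∧ not (adj G a a)) (==-refl a)
    }

  2*nC2+n≡n*n : ∀ n → 2 * (n C 2) + n ≡ n * n
  2*nC2+n≡n*n zero    = refl
  2*nC2+n≡n*n (suc n) = begin
    2 * (suc n C 2) + suc n          ≡⟨ cong (λ x → 2 * x + suc n) (sym (nCk+nC[k+1]≡[n+1]C[k+1] n 1)) ⟩
    2 * (n C 1 + n C 2) + suc n      ≡⟨ cong (λ x → 2 * (x + n C 2) + suc n) (nC1≡n n) ⟩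
    2 * (n + n C 2) + suc n          ≡⟨ regroup n (n C 2) ⟩
    2 * (n C 2) + n + suc (n + n)    ≡⟨ cong (_+ suc (n + n)) (2*nC2+n≡n*n n) ⟩
    n * n + suc (n + n)              ≡⟨ square n ⟩
    suc n * suc n                    ∎
    where
    open ≡-Reasoning
    regroup : ∀ n c → 2 * (n + c) + suc n ≡ 2 * c + n + suc (n + n)
    regroup = solve-∀
    square : ∀ n → n * n + suc (n + n) ≡ suc n * suc n
    square = solve-∀

  degree≡deg : ∀ {n} (G : Graph n) v → degree G v ≡ deg G v
  degree≡deg G v = count≡∣∣ (adj G v)

  2*edges≡degreeSum : ∀ {n} (G : Graph n) → 2 * edges G ≡ degreeSum G
  2*edges≡degreeSum G = 2*pairCount (adj G) (adj-sym G) (adj-irrefl G)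

  module _ {n : ℕ} (G : Graph n) where

    private
      Gᶜ = complement G

    deg+deg-complement : ∀ v → deg G v + deg Gᶜ v + 1 ≡ n
    deg+deg-complement v = begin
      deg G v + deg Gᶜ v + 1
        ≡⟨ cong (deg G v + deg Gᶜ v +_) (sym (∑-select v (λ _ → 1))) ⟩
      deg G v + deg Gᶜ v + ∑[ b < n ] (⟦ b == v ⟧ * 1)
        ≡⟨ cong (_+ ∑[ b < n ] (⟦ b == v ⟧ * 1)) (sym (∑-distrib-+ (λ b → ⟦ adj G v b ⟧) (λ b → ⟦ adj Gᶜ v b ⟧))) ⟩
      ∑[ b < n ] (⟦ adj G v b ⟧ + ⟦ adj Gᶜ v b ⟧) + ∑[ b < n ] (⟦ b == v ⟧ * 1)
        ≡⟨ sym (∑-distrib-+ (λ b → ⟦ adj G v b ⟧ + ⟦ adj Gᶜ v b ⟧) (λ b → ⟦ b == v ⟧ * 1)) ⟩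
      ∑[ b < n ] (⟦ adj G v b ⟧ + ⟦ adj Gᶜ v b ⟧ + ⟦ b == v ⟧ * 1)
        ≡⟨ sum-cong-≗ exactly-one ⟩
      ∑[ b < n ] 1
        ≡⟨ trans (∑-const n 1) (*-identityʳ n) ⟩
      n ∎
      where
      open ≡-Reasoning
      exactly-one : ∀ b → ⟦ adj G v b ⟧ + ⟦ adj Gᶜ v b ⟧ + ⟦ b == v ⟧ * 1 ≡ 1
      exactly-one b rewrite ==-sym b v with v ≟ b
      ... | yes refl rewrite adj-irrefl G v = refl
      ... | no _ with adj G v b
      ...   | true  = refl
      ...   | false = refl

    degreeSum+degreeSum-complement : degreeSum G + degreeSum Gᶜ + n ≡ n * n
    degreeSum+degreeSum-complement = begin
      degreeSum G + degreeSum Gᶜ + n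
        ≡⟨ cong (degreeSum G + degreeSum Gᶜ +_) (sym (trans (∑-const n 1) (*-identityʳ n))) ⟩
      degreeSum G + degreeSum Gᶜ + ∑[ v < n ] 1
        ≡⟨ cong (_+ ∑[ v < n ] 1) (sym (∑-distrib-+ (deg G) (deg Gᶜ))) ⟩
      ∑[ v < n ] (deg G v + deg Gᶜ v) + ∑[ v < n ] 1
        ≡⟨ sym (∑-distrib-+ (λ v → deg G v + deg Gᶜ v) (λ _ → 1)) ⟩
      ∑[ v < n ] (deg G v + deg Gᶜ v + 1)
        ≡⟨ sum-cong-≗ deg+deg-complement ⟩
      ∑[ v < n ] n
        ≡⟨ ∑-const n n ⟩
      n * n ∎
      where open ≡-Reasoning

    edges+edges-complement : edges G + edges Gᶜ ≡ n C 2
    edges+edges-complement = *-cancelˡ-≡ _ _ 2 (+-cancelʳ-≡ n _ _ (begin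
      2 * (edges G + edges Gᶜ) + n
        ≡⟨ cong (_+ n) (trans (*-distribˡ-+ 2 (edges G) _) (cong₂ _+_ (2*edges≡degreeSum G) (2*edges≡degreeSum Gᶜ))) ⟩
      degreeSum G + degreeSum Gᶜ + n
        ≡⟨ degreeSum+degreeSum-complement ⟩
      n * n
        ≡⟨ sym (2*nC2+n≡n*n n) ⟩
      2 * (n C 2) + n ∎))
      where open ≡-Reasoning

    private
      triangle : Fin n → Fin n → Fin n → Bool
      triangle v u w = adj G v u ∧ (adj G v w ∧ adj G u w)

      neighbourPair : Fin n → Fin n → Fin n → Bool
      neighbourPair v u w = adj G v u ∧ (adj G v w ∧ not (u == w))

      closedNbhd-complement : ∀ v u → closedNbhd Gᶜ v u ≡ not (adj G v u)
      closedNbhd-complement v u rewrite ==-sym v u with u ≟ v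
      ... | yes refl rewrite adj-irrefl G u = refl
      ... | no _     = refl

      -- A non-adjacent pair u ≠ w either lies in N_G(v) or has an endpoint in N_Gᶜ[v].
      pair-split : ∀ x y a e → (e ≡ true → a ≡ false) →
        ⟦ x ∧ (y ∧ a) ⟧ + ⟦ not e ∧ not a ⟧ ≡ ⟦ x ∧ (y ∧ not e) ⟧ + ⟦ (not e ∧ not a) ∧ (not x ∨ not y) ⟧
      pair-split x     y     a     true  e⇒¬a rewrite e⇒¬a refl = refl
      pair-split true  true  true  false _ = refl
      pair-split true  true  false false _ = refl
      pair-split true  false true  false _ = refl
      pair-split true  false false false _ = refl
      pair-split false true  true  false _ = refl
      pair-split false true  false false _ = refl
      pair-split false false true  false _ = refl
      pair-split false false false false _ = refl

    2*triangleDegree : ∀ v → 2 * triangleDegree G v ≡ ∑[ u < n ] ∑[ w < n ] ⟦ triangle v u w ⟧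
    2*triangleDegree v = 2*pairCount (triangle v) triangle-sym triangle-irrefl
      where
      triangle-sym : ∀ u w → triangle v u w ≡ triangle v w u
      triangle-sym u w rewrite adj-sym G u w with adj G v u | adj G v w
      ... | true  | true  = refl
      ... | true  | false = refl
      ... | false | true  = refl
      ... | false | false = refl
      triangle-irrefl : ∀ u → triangle v u u ≡ false
      triangle-irrefl u rewrite adj-irrefl G u | ∧-zeroʳ (adj G v u) = ∧-zeroʳ (adj G v u)

    neighbourPairs+deg : ∀ v → ∑[ u < n ] ∑[ w < n ] ⟦ neighbourPair v u w ⟧ + deg G v ≡ deg G v * deg G v
    neighbourPairs+deg v = begin
      ∑[ u < n ] ∑[ w < n ] ⟦ neighbourPair v u w ⟧ + deg G v
        ≡⟨ cong (∑[ u < n ] ∑[ w < n ] ⟦ neighbourPair v u w ⟧ +_) (sym (sum-cong-≗ diagonal)) ⟩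
      ∑[ u < n ] ∑[ w < n ] ⟦ neighbourPair v u w ⟧ + ∑[ u < n ] ∑[ w < n ] (⟦ w == u ⟧ * ⟦ adj G v u ⟧)
        ≡⟨ sym (∑∑-distrib-+ (λ u w → ⟦ neighbourPair v u w ⟧) (λ u w → ⟦ w == u ⟧ * ⟦ adj G v u ⟧)) ⟩
      ∑[ u < n ] ∑[ w < n ] (⟦ neighbourPair v u w ⟧ + ⟦ w == u ⟧ * ⟦ adj G v u ⟧)
        ≡⟨ sum-cong-≗ (λ u → sum-cong-≗ (all-pairs u)) ⟩
      ∑[ u < n ] ∑[ w < n ] (⟦ adj G v u ⟧ * ⟦ adj G v w ⟧)
        ≡⟨ sum-cong-≗ (λ u → sym (*-distribˡ-sum ⟦ adj G v u ⟧ (λ w → ⟦ adj G v w ⟧))) ⟩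
      ∑[ u < n ] (⟦ adj G v u ⟧ * deg G v)
        ≡⟨ sym (*-distribʳ-sum (deg G v) (λ u → ⟦ adj G v u ⟧)) ⟩
      deg G v * deg G v ∎
      where
      open ≡-Reasoning
      diagonal : ∀ u → ∑[ w < n ] (⟦ w == u ⟧ * ⟦ adj G v u ⟧) ≡ ⟦ adj G v u ⟧
      diagonal u = ∑-select u (λ _ → ⟦ adj G v u ⟧)
      all-pairs : ∀ u w → ⟦ neighbourPair v u w ⟧ + ⟦ w == u ⟧ * ⟦ adj G v u ⟧ ≡ ⟦ adj G v u ⟧ * ⟦ adj G v w ⟧
      all-pairs u w rewrite ==-sym w u with u ≟ w
      ... | yes refl with adj G v u
      ...   | true  = refl
      ...   | false = refl
      all-pairs u w | no _ with adj G v u | adj G v w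
      ...   | true  | true  = refl
      ...   | true  | false = refl
      ...   | false | _     = refl

    triangles+degreeSum-complement : ∀ v →
      ∑[ u < n ] ∑[ w < n ] ⟦ triangle v u w ⟧ + degreeSum Gᶜ ≡ ∑[ u < n ] ∑[ w < n ] ⟦ neighbourPair v u w ⟧ + arcsNear Gᶜ v
    triangles+degreeSum-complement v = begin
      ∑[ u < n ] ∑[ w < n ] ⟦ triangle v u w ⟧ + degreeSum Gᶜ
        ≡⟨ sym (∑∑-distrib-+ (λ u w → ⟦ triangle v u w ⟧) (λ u w → ⟦ adj Gᶜ u w ⟧)) ⟩
      ∑[ u < n ] ∑[ w < n ] (⟦ triangle v u w ⟧ + ⟦ adj Gᶜ u w ⟧)
        ≡⟨ sum-cong-≗ (λ u → sum-cong-≗ (split u)) ⟩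
      ∑[ u < n ] ∑[ w < n ] (⟦ neighbourPair v u w ⟧ + arcNear u w)
        ≡⟨ ∑∑-distrib-+ (λ u w → ⟦ neighbourPair v u w ⟧) arcNear ⟩
      ∑[ u < n ] ∑[ w < n ] ⟦ neighbourPair v u w ⟧ + arcsNear Gᶜ v ∎
      where
      open ≡-Reasoning
      arcNear : Fin n → Fin n → ℕ
      arcNear u w = ⟦ adj Gᶜ u w ∧ (closedNbhd Gᶜ v u ∨ closedNbhd Gᶜ v w) ⟧
      split : ∀ u w → ⟦ triangle v u w ⟧ + ⟦ adj Gᶜ u w ⟧ ≡ ⟦ neighbourPair v u w ⟧ + arcNear u w
      split u w = trans
        (pair-split (adj G v u) (adj G v w) (adj G u w) (u == w)
          (λ u=w → trans (cong (adj G u) (sym (==⇒≡ u=w))) (adj-irrefl G u)))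
        (cong (λ N → ⟦ neighbourPair v u w ⟧ + ⟦ adj Gᶜ u w ∧ N ⟧)
          (sym (cong₂ _∨_ (closedNbhd-complement v u) (closedNbhd-complement v w))))

    triangleDegree-identity : ∀ v →
      2 * triangleDegree G v + degreeSum Gᶜ + deg G v ≡ deg G v * deg G v + arcsNear Gᶜ v
    triangleDegree-identity v = begin
      2 * triangleDegree G v + degreeSum Gᶜ + deg G v
        ≡⟨ cong (λ x → x + degreeSum Gᶜ + deg G v) (2*triangleDegree v) ⟩
      ∑[ u < n ] ∑[ w < n ] ⟦ triangle v u w ⟧ + degreeSum Gᶜ + deg G v
        ≡⟨ cong (_+ deg G v) (triangles+degreeSum-complement v) ⟩
      neighbourPairs + arcsNear Gᶜ v + deg G v
        ≡⟨ xy∙z≈xz∙y neighbourPairs (arcsNear Gᶜ v) (deg G v) ⟩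
      neighbourPairs + deg G v + arcsNear Gᶜ v
        ≡⟨ cong (_+ arcsNear Gᶜ v) (neighbourPairs+deg v) ⟩
      deg G v * deg G v + arcsNear Gᶜ v ∎
      where
      open ≡-Reasoning
      neighbourPairs = ∑[ u < n ] ∑[ w < n ] ⟦ neighbourPair v u w ⟧

    distinctTriangles⇒distinctArcsNear : TriangleDistinct G →
      ∀ v w → deg G v ≡ deg G w → arcsNear Gᶜ v ≡ arcsNear Gᶜ w → v ≡ w
    distinctTriangles⇒distinctArcsNear td v w dv≡dw av≡aw = TriangleDistinct.distinct td v w
      (*-cancelˡ-≡ _ _ 2 (+-cancelʳ-≡ (degreeSum Gᶜ) _ _ (+-cancelʳ-≡ (deg G w) _ _ (begin
        2 * triangleDegree G v + degreeSum Gᶜ + deg G w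
          ≡⟨ cong (2 * triangleDegree G v + degreeSum Gᶜ +_) (sym dv≡dw) ⟩
        2 * triangleDegree G v + degreeSum Gᶜ + deg G v
          ≡⟨ triangleDegree-identity v ⟩
        deg G v * deg G v + arcsNear Gᶜ v
          ≡⟨ cong₂ (λ d a → d * d + a) dv≡dw av≡aw ⟩
        deg G w * deg G w + arcsNear Gᶜ w
          ≡⟨ sym (triangleDegree-identity w) ⟩
        2 * triangleDegree G w + degreeSum Gᶜ + deg G w ∎))))
      where open ≡-Reasoning

  numOfDegree-bound : ∀ {n} (G : Graph n) → TriangleDistinct G → ∀ k → 1 ≤ k → k ≤ n →
    numOfDegree G (n ∸ k) ^ (2 ^ (k ∸ 1)) ≤ (8 * edges (complement G)) ^ (2 ^ (k ∸ 1) ∸ 1)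
  numOfDegree-bound {n} G td k 1≤k k≤n =
    subst₂ (λ m Y → m ^ (2 ^ (k ∸ 1)) ≤ Y ^ (2 ^ (k ∸ 1) ∸ 1)) (sym (count≡∣∣ t)) 4*degreeSum≡8*edges
      (distinctArcsNear-bound (k ∸ 1) (complement G) t deg-complement≡k-1
        (λ v w tv tw → distinctTriangles⇒distinctArcsNear G td v w (trans (deg≡n-k v tv) (sym (deg≡n-k w tw)))))
    where
    t : Fin n → Bool
    t v = degree G v ≡ᵇ (n ∸ k)
    -- does (x ≟ℕ y) unfolds to x ≡ᵇ y.
    deg≡n-k : ∀ v → t v ≡ true → deg G v ≡ n ∸ k
    deg≡n-k v tv = trans (sym (degree≡deg G v)) (does⇒ (degree G v ≟ℕ (n ∸ k)) tv)
    deg-complement≡k-1 : ∀ v → t v ≡ true → deg (complement G) v ≡ k ∸ 1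
    deg-complement≡k-1 v tv = begin
      deg (complement G) v                ≡⟨ sym (m+n∸n≡m _ 1) ⟩
      deg (complement G) v + 1 ∸ 1        ≡⟨ cong (_∸ 1) (+-cancelˡ-≡ (n ∸ k) _ _ sums-to-n) ⟩
      k ∸ 1                               ∎
      where
      open ≡-Reasoning
      sums-to-n : n ∸ k + (deg (complement G) v + 1) ≡ n ∸ k + k
      sums-to-n = begin
        n ∸ k + (deg (complement G) v + 1)
          ≡⟨ sym (+-assoc (n ∸ k) _ 1) ⟩
        n ∸ k + deg (complement G) v + 1
          ≡⟨ cong (λ d → d + deg (complement G) v + 1) (sym (deg≡n-k v tv)) ⟩
        deg G v + deg (complement G) v + 1
          ≡⟨ deg+deg-complement G v ⟩
        n
          ≡⟨ sym (m∸n+n≡m k≤n) ⟩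
        n ∸ k + k ∎
    4*degreeSum≡8*edges : 4 * degreeSum (complement G) ≡ 8 * edges (complement G)
    4*degreeSum≡8*edges = trans (cong (4 *_) (sym (2*edges≡degreeSum (complement G)))) (sym (*-assoc 4 2 (edges (complement G))))


module RationalEmbedding where

  open import Data.Nat as ℕ using (ℕ; zero; suc)
  open import Data.Integer as ℤ using (+_)
  import Data.Integer.Properties as ℤ
  open import Data.Nat.Coprimality using (1-coprimeTo) renaming (sym to coprime-sym)
  open import Data.Rational using (toℚᵘ; _+_; _*_; _≤_; 0ℚ; nonNegative)
  open import Data.Rational.Properties
  import Data.Rational.Unnormalised as ℚᵘ
  import Data.Rational.Unnormalised.Properties as ℚᵘ
  open import Data.Rational.Solver using (module +-*-Solver)
  open import Relation.Binary.PropositionalEquality using (_≡_; refl; sym; trans; cong; cong₂; subst₂)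
  open +-*-Solver using (solve; _:=_; _:*_)

  toℚᵘ-ℕ→ℚ : ∀ m → toℚᵘ (ℕ→ℚ m) ≡ ℚᵘ.mkℚᵘ (+ m) 0
  toℚᵘ-ℕ→ℚ m = cong toℚᵘ (normalize-coprime (coprime-sym (1-coprimeTo m)))

  ℕ→ℚ-+ : ∀ a b → ℕ→ℚ (a ℕ.+ b) ≡ ℕ→ℚ a + ℕ→ℚ b
  ℕ→ℚ-+ a b = toℚᵘ-injective (begin
    toℚᵘ (ℕ→ℚ (a ℕ.+ b))                        ≡⟨ toℚᵘ-ℕ→ℚ (a ℕ.+ b) ⟩
    ℚᵘ.mkℚᵘ (+ (a ℕ.+ b)) 0                      ≈⟨ ℚᵘ.*≡* numerators ⟩
    ℚᵘ.mkℚᵘ (+ a) 0 ℚᵘ.+ ℚᵘ.mkℚᵘ (+ b) 0         ≡⟨ sym (cong₂ ℚᵘ._+_ (toℚᵘ-ℕ→ℚ a) (toℚᵘ-ℕ→ℚ b)) ⟩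
    toℚᵘ (ℕ→ℚ a) ℚᵘ.+ toℚᵘ (ℕ→ℚ b)              ≈⟨ toℚᵘ-homo-+ (ℕ→ℚ a) (ℕ→ℚ b) ⟨
    toℚᵘ (ℕ→ℚ a + ℕ→ℚ b)                        ∎)
    where
    open ℚᵘ.≃-Reasoning
    numerators : + (a ℕ.+ b) ℤ.* + 1 ≡ (+ a ℤ.* + 1 ℤ.+ + b ℤ.* + 1) ℤ.* + 1
    numerators = cong (ℤ._* + 1) (trans (ℤ.pos-+ a b) (sym (cong₂ ℤ._+_ (ℤ.*-identityʳ (+ a)) (ℤ.*-identityʳ (+ b)))))

  ℕ→ℚ-* : ∀ a b → ℕ→ℚ (a ℕ.* b) ≡ ℕ→ℚ a * ℕ→ℚ b
  ℕ→ℚ-* a b = toℚᵘ-injective (begin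
    toℚᵘ (ℕ→ℚ (a ℕ.* b))                        ≡⟨ toℚᵘ-ℕ→ℚ (a ℕ.* b) ⟩
    ℚᵘ.mkℚᵘ (+ (a ℕ.* b)) 0                      ≈⟨ ℚᵘ.*≡* (cong (ℤ._* + 1) (ℤ.pos-* a b)) ⟩
    ℚᵘ.mkℚᵘ (+ a) 0 ℚᵘ.* ℚᵘ.mkℚᵘ (+ b) 0         ≡⟨ sym (cong₂ ℚᵘ._*_ (toℚᵘ-ℕ→ℚ a) (toℚᵘ-ℕ→ℚ b)) ⟩
    toℚᵘ (ℕ→ℚ a) ℚᵘ.* toℚᵘ (ℕ→ℚ b)              ≈⟨ toℚᵘ-homo-* (ℕ→ℚ a) (ℕ→ℚ b) ⟨
    toℚᵘ (ℕ→ℚ a * ℕ→ℚ b)                        ∎)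
    where open ℚᵘ.≃-Reasoning

  ℕ→ℚ-mono-≤ : ∀ {a b} → a ℕ.≤ b → ℕ→ℚ a ≤ ℕ→ℚ b
  ℕ→ℚ-mono-≤ {a} {b} a≤b = toℚᵘ-cancel-≤ (subst₂ ℚᵘ._≤_ (sym (toℚᵘ-ℕ→ℚ a)) (sym (toℚᵘ-ℕ→ℚ b))
    (ℚᵘ.*≤* (ℤ.*-monoʳ-≤-nonNeg (+ 1) (ℤ.+≤+ a≤b))))

  ℕ→ℚ-nonNeg : ∀ a → 0ℚ ≤ ℕ→ℚ a
  ℕ→ℚ-nonNeg a = ℕ→ℚ-mono-≤ {0} {a} ℕ.z≤n

  ℕ→ℚ-^ : ∀ a r → ℕ→ℚ (a ℕ.^ r) ≡ ℕ→ℚ a ^ℚ r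
  ℕ→ℚ-^ a zero    = refl
  ℕ→ℚ-^ a (suc r) = trans (ℕ→ℚ-* a (a ℕ.^ r)) (cong (ℕ→ℚ a *_) (ℕ→ℚ-^ a r))

  ^ℚ-nonNeg : ∀ {p} r → 0ℚ ≤ p → 0ℚ ≤ p ^ℚ r
  ^ℚ-nonNeg zero    0≤p = ℕ→ℚ-nonNeg 1
  ^ℚ-nonNeg {p} (suc r) 0≤p =
    nonNegative⁻¹ _ {{nonNeg*nonNeg⇒nonNeg p {{nonNegative 0≤p}} (p ^ℚ r) {{nonNegative (^ℚ-nonNeg r 0≤p)}}}}

  ^ℚ-monoˡ-≤ : ∀ {p q} r → 0ℚ ≤ p → p ≤ q → p ^ℚ r ≤ q ^ℚ r
  ^ℚ-monoˡ-≤ zero    0≤p p≤q = ≤-refl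
  ^ℚ-monoˡ-≤ {p} {q} (suc r) 0≤p p≤q = ≤-trans
    (*-monoʳ-≤-nonNeg (p ^ℚ r) {{nonNegative (^ℚ-nonNeg r 0≤p)}} p≤q)
    (*-monoˡ-≤-nonNeg q {{nonNegative (≤-trans 0≤p p≤q)}} (^ℚ-monoˡ-≤ r 0≤p p≤q))

  ^ℚ-distribʳ-* : ∀ p q r → (p * q) ^ℚ r ≡ p ^ℚ r * q ^ℚ r
  ^ℚ-distribʳ-* p q zero    = refl
  ^ℚ-distribʳ-* p q (suc r) = trans (cong (p * q *_) (^ℚ-distribʳ-* p q r))
    (solve 4 (λ p q x y → (p :* q) :* (x :* y) := (p :* x) :* (q :* y)) refl p q (p ^ℚ r) (q ^ℚ r))


module Density where

  open import Data.Nat as ℕ using (zero; suc; z≤n; s≤s)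
  import Data.Nat.Properties as ℕ
  open import Data.Nat.Combinatorics using (_C_)
  open import Data.Rational using (Positive; _+_; _*_; _-_; _≤_; 0ℚ; nonNegative)
  open import Data.Rational.Properties
  open import Data.Rational.Solver using (module +-*-Solver)
  open import Relation.Binary.PropositionalEquality using (_≡_; refl; sym; trans; cong)
  open +-*-Solver using (solve; _:=_; _:+_; _:*_; _:-_)
  open Complement using (complement; edges+edges-complement)
  open RationalEmbedding

  2^[2^[k-1]-1]≤k^2^[k-1] : ∀ k → 1 ℕ.≤ k → 2 ℕ.^ (2 ℕ.^ (k ℕ.∸ 1) ℕ.∸ 1) ℕ.≤ k ℕ.^ (2 ℕ.^ (k ℕ.∸ 1))
  2^[2^[k-1]-1]≤k^2^[k-1] (suc zero)    _ = ℕ.≤-refl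
  2^[2^[k-1]-1]≤k^2^[k-1] (suc (suc k)) _ =
    ℕ.≤-trans (ℕ.^-monoʳ-≤ 2 (ℕ.m∸n≤m N 1)) (ℕ.^-monoˡ-≤ N (s≤s (s≤s z≤n)))
    where N = 2 ℕ.^ suc k

  8*edges-complement≤ : ∀ {n} (G : Graph n) c → ℕ→ℚ (n C 2) - c * ℕ→ℚ n ≤ ℕ→ℚ (edges G) →
    ℕ→ℚ (8 ℕ.* edges (complement G)) ≤ ℕ→ℚ 2 * (ℕ→ℚ 4 * c * ℕ→ℚ n)
  8*edges-complement≤ {n} G c dense = begin
    ℕ→ℚ (8 ℕ.* edges (complement G))
      ≡⟨ ℕ→ℚ-* 8 (edges (complement G)) ⟩
    ℕ→ℚ 8 * f
      ≡⟨ cong (ℕ→ℚ 8 *_) (solve 2 (λ e f → f := (e :+ f) :- e) refl e f) ⟩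
    ℕ→ℚ 8 * ((e + f) - e)
      ≡⟨ cong (λ x → ℕ→ℚ 8 * (x - e)) e+f≡Cn2 ⟩
    ℕ→ℚ 8 * (Cn2 - e)
      ≤⟨ *-monoˡ-≤-nonNeg (ℕ→ℚ 8) {{nonNegative (ℕ→ℚ-nonNeg 8)}}
                                                     (+-monoʳ-≤ Cn2 (neg-antimono-≤ dense)) ⟩
    ℕ→ℚ 8 * (Cn2 - (Cn2 - c * ℕ→ℚ n))
      ≡⟨ cong (λ x → x * (Cn2 - (Cn2 - c * ℕ→ℚ n))) (ℕ→ℚ-* 2 4) ⟩
    ℕ→ℚ 2 * ℕ→ℚ 4 * (Cn2 - (Cn2 - c * ℕ→ℚ n))
      ≡⟨ solve 5 (λ a b C c n → a :* b :* (C :- (C :- c :* n)) := a :* (b :* c :* n))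
                                                         refl (ℕ→ℚ 2) (ℕ→ℚ 4) Cn2 c (ℕ→ℚ n) ⟩
    ℕ→ℚ 2 * (ℕ→ℚ 4 * c * ℕ→ℚ n) ∎
    where
    open ≤-Reasoning
    e = ℕ→ℚ (edges G)
    f = ℕ→ℚ (edges (complement G))
    Cn2 = ℕ→ℚ (n C 2)
    e+f≡Cn2 : e + f ≡ Cn2
    e+f≡Cn2 = trans (sym (ℕ→ℚ-+ (edges G) (edges (complement G)))) (cong ℕ→ℚ (edges+edges-complement G))

  0≤4cn : ∀ {c} n → Positive c → 0ℚ ≤ ℕ→ℚ 4 * c * ℕ→ℚ n
  0≤4cn {c} n c>0 = nonNegative⁻¹ _ {{nonNeg*nonNeg⇒nonNeg (ℕ→ℚ 4 * c) {{4c≥0}} (ℕ→ℚ n) {{n≥0}}}}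
    where
    n≥0 = nonNegative (ℕ→ℚ-nonNeg n)
    4c≥0 = nonNeg*nonNeg⇒nonNeg (ℕ→ℚ 4) {{nonNegative (ℕ→ℚ-nonNeg 4)}} c {{pos⇒nonNeg c {{c>0}}}}


import Data.Nat as ℕ
open import Data.Nat using (ℕ; _∸_; _^_; _≤_)
open import Data.Nat.Combinatorics using (_C_)
open import Data.Rational using (ℚ; Positive; _*_; _-_; nonNegative) renaming (_≤_ to _≤ℚ_)
open import Data.Rational.Properties using (module ≤-Reasoning; *-monoʳ-≤-nonNeg)
open import Relation.Binary.PropositionalEquality using (sym; cong)
open Complement using (complement; numOfDegree-bound)
open RationalEmbedding
open Density

corollary7 : (n : ℕ) (G : Graph n) → TriangleDistinct G →
    (c : ℚ) → Positive c →
    ℕ→ℚ (n C 2) - c * ℕ→ℚ n ≤ℚ ℕ→ℚ (edges G) →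
    (k : ℕ) → 1 ≤ k → k ≤ n →
    ℕ→ℚ (numOfDegree G (n ∸ k)) ^ℚ (2 ^ (k ∸ 1))
      ≤ℚ ℕ→ℚ k ^ℚ (2 ^ (k ∸ 1)) * ((ℕ→ℚ 4 * c * ℕ→ℚ n) ^ℚ (2 ^ (k ∸ 1) ∸ 1))
corollary7 n G td c c>0 dense k 1≤k k≤n = begin
  ℕ→ℚ m ^ℚ N              ≡⟨ sym (ℕ→ℚ-^ m N) ⟩
  ℕ→ℚ (m ^ N)             ≤⟨ ℕ→ℚ-mono-≤ (numOfDegree-bound G td k 1≤k k≤n) ⟩
  ℕ→ℚ (Y ^ M)             ≡⟨ ℕ→ℚ-^ Y M ⟩
  ℕ→ℚ Y ^ℚ M              ≤⟨ ^ℚ-monoˡ-≤ M (ℕ→ℚ-nonNeg Y) (8*edges-complement≤ G c dense) ⟩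
  (ℕ→ℚ 2 * q) ^ℚ M        ≡⟨ ^ℚ-distribʳ-* (ℕ→ℚ 2) q M ⟩
  ℕ→ℚ 2 ^ℚ M * q ^ℚ M     ≡⟨ cong (_* q ^ℚ M) (sym (ℕ→ℚ-^ 2 M)) ⟩
  ℕ→ℚ (2 ^ M) * q ^ℚ M    ≤⟨ *-monoʳ-≤-nonNeg (q ^ℚ M) {{nonNegative (^ℚ-nonNeg M (0≤4cn {c} n c>0))}}
                                 (ℕ→ℚ-mono-≤ (2^[2^[k-1]-1]≤k^2^[k-1] k 1≤k)) ⟩
  ℕ→ℚ (k ^ N) * q ^ℚ M    ≡⟨ cong (_* q ^ℚ M) (ℕ→ℚ-^ k N) ⟩
  ℕ→ℚ k ^ℚ N * q ^ℚ M     ∎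
  where
  open ≤-Reasoning
  m = numOfDegree G (n ∸ k)
  N = 2 ^ (k ∸ 1)
  M = N ∸ 1
  Y = 8 ℕ.* edges (complement G)
  q = ℕ→ℚ 4 * c * ℕ→ℚ n
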